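{- For every $t\in\mathbb{N}$ there exists $c=c(t)\in\mathbb{N}$ with the following property. Let $G$ be a $K_{t,t}$-free graph, $\omega=\omega(G)$, $Z\subseteq V(G)$ with $|Z|\geq 2$, $H$ a graph, and $\eta$ an extended strip decomposition of $(G,Z)$ with pattern $H$. Then for every vertex $v\in V(G)\setminus Z$ there are at most $\omega^c$ leaf paths ending at $v$ that are pairwise vertex-disjoint except at $v$.
   Context: Graphs are finite and simple; $K_{t,t}$-free means no induced subgraph isomorphic to $K_{t,t}$; paths are induced paths; $\omega(G)$ is the clique number. Extended strip decomposition: let $G,H$ be graphs, $Z\subseteq V(G)$, $W$ the set of degree-one vertices of $H$, $T(H)$ the set of triangles of $H$. An extended strip decomposition of $(G,Z)$ with pattern $H$ is a map $\eta$ from $E(H)\cup V(H)\cup T(H)\cup\{(e,v): e\in E(H), v \text{ an end of } e\}$ to $2^{V(G)}$ such that: (1) every $v\in V(G)$ lies in $\eta(x)$ for a unique $x\in E(H)\cup V(H)\cup T(H)$; (2) $\eta(e,v)\subseteq\eta(e)$; (3) for distinct $e,f\in E(H)$, $x\in\eta(e)$, $y\in\eta(f)$: $xy\in E(G)$ iff $e,f$ share an end $v$ with $x\in\eta(e,v)$, $y\in\eta(f,v)$; (4) if $v\in V(H)$, $x\in\eta(v)$, $y\notin\eta(v)$, $xy\in E(G)$, then $y\in\eta(e,v)$ for some edge $e$ incident with $v$; (5) if $D\in T(H)$, $x\in\eta(D)$, $y\notin\eta(D)$, $xy\in E(G)$, then $y\in\eta(e,u)\cap\eta(e,v)$ for some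 distinct $u,v\in D$ with $e=uv$; (6) $|Z|=|W|$ and for each $z\in Z$ there is $w\in W$ with $\eta(e,w)=\{z\}$, where $e$ is the edge of $H$ incident with $w$. A leaf path ending at $v$ is a path $p_1\text{ - }\dots\text{ - }p_k$ of $G$ with $p_1\in Z$ and $p_k=v$. -}

module Defs where

open import Data.Nat using (ℕ; zero; suc; _<_; _≤_; _^_)
open import Data.Fin using (Fin; toℕ; fromℕ)
open import Data.Fin.Subset using (Subset; _∈_; _∉_; ∣_∣)
open import Data.Vec using (tabulate)
open import Data.Unit using (⊤)
open import Data.Bool using (Bool; true; false)
open import Data.Product using (Σ; _×_; _,_; ∃)
open import Data.Sum using (_⊎_)
open import Relation.Binary.PropositionalEquality using (_≡_; _≢_)
open import Relation.Nullary using (¬_)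
open import Function using (_⇔_)
open import Function.Definitions using (Injective)

record Graph (n : ℕ) : Set where
  field
    adj    : Fin n → Fin n → Bool
    sym    : ∀ u v → adj u v ≡ adj v u
    irrefl : ∀ u → adj u u ≡ false
open Graph public

Adj : ∀ {n} → Graph n → Fin n → Fin n → Set
Adj G u v = adj G u v ≡ true

nbhd : ∀ {n} → Graph n → Fin n → Subset n
nbhd G u = tabulate (λ v → adj G u v)

degree : ∀ {n} → Graph n → Fin n → ℕ
degree G u = ∣ nbhd G u ∣

isDeg1 : ℕ → Bool
isDeg1 (suc zero) = true
isDeg1 _          = false

degreeOne : ∀ {n} → Graph n → Subset n
degreeOne G = tabulate (λ u → isDeg1 (degree G u))

IsClique : ∀ {n s} → Graph n → (Fin s → Fin n) → Set
IsClique G f = Injective _≡_ _≡_ f × (∀ i j → i ≢ j → Adj G (f i) (f j))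

HasCliqueOfSize : ∀ {n} → Graph n → ℕ → Set
HasCliqueOfSize {n} G s = Σ (Fin s → Fin n) (IsClique G)

IsCliqueNumber : ∀ {n} → Graph n → ℕ → Set
IsCliqueNumber G ω = HasCliqueOfSize G ω × ¬ HasCliqueOfSize G (suc ω)

IsInducedKtt : ∀ {n} (t : ℕ) → Graph n → (Fin t → Fin n) → (Fin t → Fin n) → Set
IsInducedKtt t G a b =
  Injective _≡_ _≡_ a × Injective _≡_ _≡_ b × (∀ i j → a i ≢ b j)
  × (∀ i j → Adj G (a i) (b j))
  × (∀ i j → adj G (a i) (a j) ≡ false)
  × (∀ i j → adj G (b i) (b j) ≡ false)

KttFree : ∀ {n} → ℕ → Graph n → Set
KttFree {n} t G = ¬ Σ (Fin t → Fin n) λ a → Σ (Fin t → Fin n) λ b → IsInducedKtt t G a b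

-- An edge {a,b} is written pe a b with a < b; a triangle {a,b,c} as pt a b c
-- with a < b < c.  IsPiece singles out the genuine elements of
-- V(H) ∪ E(H) ∪ T(H).

data Piece (m : ℕ) : Set where
  pv : Fin m → Piece m
  pe : Fin m → Fin m → Piece m
  pt : Fin m → Fin m → Fin m → Piece m

IsEdge : ∀ {m} → Graph m → Fin m → Fin m → Set
IsEdge H a b = toℕ a < toℕ b × Adj H a b

IsTriangle : ∀ {m} → Graph m → Fin m → Fin m → Fin m → Set
IsTriangle H a b c =
  toℕ a < toℕ b × toℕ b < toℕ c × Adj H a b × Adj H a c × Adj H b c

IsPiece : ∀ {m} → Graph m → Piece m → Set
IsPiece H (pv h)     = ⊤
IsPiece H (pe a b)   = IsEdge H a b
IsPiece H (pt a b c) = IsTriangle H a b c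

-- Extended strip decomposition of (G, Z) with pattern H.
--   η p x          :  x ∈ η(p)            for p ∈ V(H) ∪ E(H) ∪ T(H)
--   ηEnd a b v x   :  x ∈ η(e, v)         for the edge e = {a,b} (a < b), v ∈ {a,b}
-- (values of η / ηEnd at non-pieces are irrelevant: every condition is
-- guarded by IsPiece / IsEdge.)

record ESD {n m : ℕ} (G : Graph n) (Z : Subset n) (H : Graph m) : Set₁ where
  field
    η    : Piece m → Fin n → Set
    ηEnd : Fin m → Fin m → Fin m → Fin n → Set
    cover  : ∀ x → Σ (Piece m) λ p → IsPiece H p × η p x
    unique : ∀ x p q → IsPiece H p → IsPiece H q → η p x → η q x → p ≡ q
    endSub : ∀ a b v x → IsEdge H a b → (v ≡ a ⊎ v ≡ b) → ηEnd a b v x → η (pe a b) x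
    edgeAdj : ∀ a b c d → IsEdge H a b → IsEdge H c d → pe a b ≢ pe c d →
              ∀ x y → η (pe a b) x → η (pe c d) y →
              Adj G x y ⇔ (Σ (Fin m) λ v → (v ≡ a ⊎ v ≡ b) × (v ≡ c ⊎ v ≡ d)
                                          × ηEnd a b v x × ηEnd c d v y)
    vertexAdj : ∀ h x y → η (pv h) x → ¬ η (pv h) y → Adj G x y →
                Σ (Fin m) λ a → Σ (Fin m) λ b →
                  IsEdge H a b × (h ≡ a ⊎ h ≡ b) × ηEnd a b h y
    triangleAdj : ∀ a b c → IsTriangle H a b c → ∀ x y →
                  η (pt a b c) x → ¬ η (pt a b c) y → Adj G x y →
                  (ηEnd a b a y × ηEnd a b b y)
                  ⊎ (ηEnd a c a y × ηEnd a c c y)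
                  ⊎ (ηEnd b c b y × ηEnd b c c y)
    sizeZW : ∣ Z ∣ ≡ ∣ degreeOne H ∣
    leaves : ∀ z → z ∈ Z → Σ (Fin m) λ w → w ∈ degreeOne H ×
               (Σ (Fin m) λ a → Σ (Fin m) λ b → IsEdge H a b × (w ≡ a ⊎ w ≡ b)
                  × (∀ y → ηEnd a b w y ⇔ y ≡ z))

IsInducedPath : ∀ {n} → Graph n → (k : ℕ) → (Fin (suc k) → Fin n) → Set
IsInducedPath G k p =
  Injective _≡_ _≡_ p ×
  (∀ i j → Adj G (p i) (p j) ⇔ (toℕ i ≡ suc (toℕ j) ⊎ toℕ j ≡ suc (toℕ i)))

record LeafPath {n : ℕ} (G : Graph n) (Z : Subset n) (v : Fin n) : Set where
  field
    len    : ℕ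
    vert   : Fin (suc len) → Fin n
    path   : IsInducedPath G len vert
    start  : vert Fin.zero ∈ Z
    finish : vert (fromℕ len) ≡ v
open LeafPath public

OnPath : ∀ {n} {G : Graph n} {Z : Subset n} {v : Fin n} → LeafPath G Z v → Fin n → Set
OnPath P x = Σ (Fin (suc (len P))) λ i → vert P i ≡ x

PairwiseDisjointExcept : ∀ {n} {G : Graph n} {Z : Subset n} (v : Fin n) {r : ℕ} →
                         (Fin r → LeafPath G Z v) → Set
PairwiseDisjointExcept v P =
  ∀ i j → i ≢ j → ∀ x → OnPath (P i) x → OnPath (P j) x → x ≡ v

-- Follow each path backwards from v.  While it stays in the strip η(ab) of an edge ab of H, or in a
-- vertex or triangle strip that it entered through an end of ab, it can leave in only two ways: it
-- starts in η(ab), which happens for at most two paths because the leaf ends of ab are singletons, or it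
-- passes from an end η(ab,u) to an end η(f,u) of another edge f at u.  Vertices in different ends at u
-- are adjacent, so Ramsey's theorem gives, among R(ω+1,t) paths of the second kind at u, t paths whose
-- first crossing vertices are pairwise non-adjacent and hence lie in a single end η(g,u), and then t
-- paths whose vertices in other ends at u are pairwise non-adjacent: together an induced K_{t,t}.
-- The paths leave the strip of v through ends at a common vertex (or triangle) of H, and entry vertices
-- of distinct edges are adjacent, so at most ω edges are used.  Hence r ≤ 2 + 2ω(2 + 2R(ω+1,t)), which
-- is at most ω^(2(t+5)) because ω ≥ 2 as soon as some leaf path ends outside Z.

module Submission where

open import Defs hiding (sym)
open import Data.Nat using (ℕ; zero; suc; _+_; _*_; _≤_; _<_; z≤n; s≤s; s≤s⁻¹; _≤?_; _<?_; _^_;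
                               NonZero; >-nonZero)
open import Data.Nat.Properties
open import Data.Fin using (Fin; zero; suc; toℕ; fromℕ<) renaming (_≟_ to _≟ᶠ_)
open import Data.Fin.Properties using (toℕ-fromℕ<; toℕ-fromℕ; fromℕ<-cong; fromℕ-def)
open import Data.Fin.Subset using (Subset; _∈_; _∉_; ∣_∣)
open import Data.Bool using (true; false) renaming (_≟_ to _≟ᵇ_)
open import Data.Product using (Σ; ∃₂; _×_; _,_; proj₁; proj₂; uncurry)
open import Data.Product.Properties using (≡-dec)
open import Data.Sum as Sum using (_⊎_; inj₁; inj₂)
open import Data.List using (List; []; _∷_; length; filter; map; allFin)
open import Data.List.Properties using (length-map; length-tabulate; filter-accept)
open import Data.List.Relation.Unary.All as All using (All; []; _∷_)
open import Data.List.Relation.Unary.All.Properties using (all-filter)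
open import Data.List.Relation.Unary.AllPairs using (AllPairs; []; _∷_)
import Data.List.Relation.Unary.AllPairs.Properties as AllPairs
open import Data.List.Relation.Unary.Unique.Propositional.Properties using (allFin⁺)
open import Data.List.Relation.Unary.Any using (here; there)
open import Data.List.Membership.Propositional using () renaming (_∈_ to _∈ˡ_)
open import Data.List.Membership.Propositional.Properties using (∈-filter⁻)
open import Data.List.Relation.Binary.Sublist.Propositional using (_⊆_; _∷ʳ_)
open import Data.List.Relation.Binary.Sublist.Propositional.Properties using (filter-⊆; filter⁺)
open import Data.List.Relation.Binary.Sublist.Heterogeneous.Properties using (length-mono-≤)
open import Data.Empty using (⊥-elim)
open import Data.Unit using (tt)
open import Relation.Nullary using (¬_; Dec; yes; no; ¬?; _×-dec_)
open import Relation.Nullary.Decidable using (map′)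
open import Relation.Binary.Definitions using (DecidableEquality)
open import Relation.Binary.PropositionalEquality using (_≡_; _≢_; refl; sym; trans; cong; subst)
open import Function using (_∘_; _⇔_)
open import Function.Bundles using (Equivalence)
open Equivalence using (to; from)

-- Ramsey's theorem and the pigeonhole principle for lists

ramseyNumber : ℕ → ℕ → ℕ
ramseyNumber zero    t       = 0
ramseyNumber (suc s) zero    = 0
ramseyNumber (suc s) (suc t) = suc (ramseyNumber s (suc t) + ramseyNumber (suc s) t)

ramseyNumber<pow : ∀ s t → ramseyNumber s t < suc s ^ t
ramseyNumber<pow zero    t       = m^n>0 1 t
ramseyNumber<pow (suc s) zero    = ≤-refl
ramseyNumber<pow (suc s) (suc t) = begin-strict
  suc (ramseyNumber s (suc t) + ramseyNumber (suc s) t)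
    <⟨ s≤s (+-monoʳ-< (ramseyNumber s (suc t)) (ramseyNumber<pow (suc s) t)) ⟩
  suc (ramseyNumber s (suc t) + suc (suc s) ^ t)
    ≤⟨ +-monoˡ-≤ _ (≤-trans (ramseyNumber<pow s (suc t)) (*-monoʳ-≤ (suc s) (^-monoˡ-≤ t (n≤1+n (suc s))))) ⟩
  suc s * suc (suc s) ^ t + suc (suc s) ^ t
    ≡⟨ +-comm (suc s * suc (suc s) ^ t) _ ⟩
  suc (suc s) ^ suc t ∎
  where open ≤-Reasoning

m+n≤o+p⇒o<m⇒n<p : ∀ {m n o p} → m + n ≤ o + p → o < m → n < p
m+n≤o+p⇒o<m⇒n<p {m} {n} {o} {p} le o<m = +-cancelˡ-< o n p (<-≤-trans (+-monoˡ-< n o<m) le)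

module _ {A : Set} where

  length-filter+reject : {P : A → Set} (P? : ∀ a → Dec (P a)) (xs : List A) →
    length xs ≡ length (filter P? xs) + length (filter (¬? ∘ P?) xs)
  length-filter+reject P? []       = refl
  length-filter+reject P? (x ∷ xs) with P? x
  ... | yes _ = cong suc (length-filter+reject P? xs)
  ... | no  _ = trans (cong suc (length-filter+reject P? xs)) (sym (+-suc _ _))

  length-filter-mono : {P : A → Set} (P? : ∀ a → Dec (P a)) {xs ys : List A} →
    xs ⊆ ys → length (filter P? xs) ≤ length (filter P? ys)
  length-filter-mono P? xs⊆ys = length-mono-≤ (filter⁺ P? P? (λ { refl p → p }) xs⊆ys)

  Clique : (A → A → Set) → List A → ℕ → Set
  Clique R xs s = Σ (Fin s → A) λ c → (∀ i → c i ∈ˡ xs) × (∀ i j → i ≢ j → R (c i) (c j))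

  module _ (R : A → A → Set) where

    clique-zero : ∀ {xs} → Clique R xs 0
    clique-zero = (λ ()) , (λ ()) , λ ()

    clique-mono : ∀ {xs ys s} → (∀ {y} → y ∈ˡ ys → y ∈ˡ xs) → Clique R ys s → Clique R xs s
    clique-mono ys⊆xs (c , c∈ys , Rc) = c , ys⊆xs ∘ c∈ys , Rc

    clique-∷ : ∀ {x xs ys s} → (∀ {y} → y ∈ˡ ys → y ∈ˡ xs × R x y × R y x) →
               Clique R ys s → Clique R (x ∷ xs) (suc s)
    clique-∷ {x} {xs} {ys} {s} ys⊆ (c , c∈ys , Rc) = c′ , c′∈ , Rc′
      where
        c′ : Fin (suc s) → A
        c′ zero    = x
        c′ (suc i) = c i
        c′∈ : ∀ i → c′ i ∈ˡ x ∷ xs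
        c′∈ zero    = here refl
        c′∈ (suc i) = there (proj₁ (ys⊆ (c∈ys i)))
        Rc′ : ∀ i j → i ≢ j → R (c′ i) (c′ j)
        Rc′ zero    zero    i≢j = ⊥-elim (i≢j refl)
        Rc′ zero    (suc j) _   = proj₁ (proj₂ (ys⊆ (c∈ys j)))
        Rc′ (suc i) zero    _   = proj₂ (proj₂ (ys⊆ (c∈ys i)))
        Rc′ (suc i) (suc j) i≢j = Rc i j (i≢j ∘ cong suc)

  module _ (R : A → A → Set) (R? : ∀ a b → Dec (R a b)) (R-sym : ∀ {a b} → R a b → R b a)
           (D : A → A → Set) (D-sym : ∀ {a b} → D a b → D b a) where

    Unrelated : A → A → Set
    Unrelated a b = D a b × ¬ R a b

    ramsey : ∀ s t xs → AllPairs D xs → ramseyNumber s t ≤ length xs →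
             Clique R xs s ⊎ Clique Unrelated xs t
    ramsey zero    t       xs _ _ = inj₁ (clique-zero R)
    ramsey (suc s) zero    xs _ _ = inj₂ (clique-zero Unrelated)
    ramsey (suc s) (suc t) (x ∷ xs) (Dx ∷ Dxs) (s≤s big)
      with ramseyNumber s (suc t) ≤? length (filter (R? x) xs)
    ... | yes manyR = Sum.map (clique-∷ R into) (clique-mono Unrelated (there ∘ out))
                              (ramsey s (suc t) _ (AllPairs.filter⁺ (R? x) Dxs) manyR)
      where
        out : ∀ {y} → y ∈ˡ filter (R? x) xs → y ∈ˡ xs
        out = proj₁ ∘ ∈-filter⁻ (R? x)
        into : ∀ {y} → y ∈ˡ filter (R? x) xs → y ∈ˡ xs × R x y × R y x
        into y∈ with ∈-filter⁻ (R? x) y∈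
        ... | y∈xs , Rxy = y∈xs , Rxy , R-sym Rxy
    ... | no fewR = Sum.map (clique-mono R (there ∘ out)) (clique-∷ Unrelated into)
                            (ramsey (suc s) t _ (AllPairs.filter⁺ (¬? ∘ R? x) Dxs) manyNotR)
      where
        out : ∀ {y} → y ∈ˡ filter (¬? ∘ R? x) xs → y ∈ˡ xs
        out = proj₁ ∘ ∈-filter⁻ (¬? ∘ R? x)
        into : ∀ {y} → y ∈ˡ filter (¬? ∘ R? x) xs → y ∈ˡ xs × Unrelated x y × Unrelated y x
        into y∈ with ∈-filter⁻ (¬? ∘ R? x) y∈
        ... | y∈xs , ¬Rxy = y∈xs , (Dxy , ¬Rxy) , (D-sym Dxy , ¬Rxy ∘ R-sym)
          where Dxy = All.lookup Dx y∈xs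
        manyNotR : ramseyNumber (suc s) t ≤ length (filter (¬? ∘ R? x) xs)
        manyNotR = <⇒≤ (m+n≤o+p⇒o<m⇒n<p (≤-trans big (≤-reflexive (length-filter+reject (R? x) xs)))
                                        (≰⇒> fewR))

  module _ {K : Set} (_≟_ : DecidableEquality K) (class : A → K)
           (R : A → A → Set) (R-across : ∀ a b → class a ≢ class b → R a b) (B : ℕ) where

    pigeonhole-clique : ∀ s xs → (∀ k → length (filter (λ a → class a ≟ k) xs) ≤ B) →
                        s * B < length xs → Clique R xs (suc s)
    pigeonhole-clique zero    (x ∷ xs) _         _   = clique-∷ R {ys = []} (λ ()) (clique-zero R)
    pigeonhole-clique (suc s) (x ∷ xs) fewInClass big =
      clique-∷ R into
        (pigeonhole-clique s others fewInOthers (m+n≤o+p⇒o<m⇒n<p big′ fewLikeX))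
      where
        Other? : ∀ a → Dec (class a ≢ class x)
        Other? a = ¬? (class a ≟ class x)
        others : List A
        others = filter Other? xs
        into : ∀ {y} → y ∈ˡ others → y ∈ˡ xs × R x y × R y x
        into y∈ with ∈-filter⁻ Other? y∈
        ... | y∈xs , other = y∈xs , R-across x _ (other ∘ sym) , R-across _ x other
        fewInOthers : ∀ k → length (filter (λ a → class a ≟ k) others) ≤ B
        fewInOthers k = ≤-trans (length-filter-mono (λ a → class a ≟ k) (x ∷ʳ filter-⊆ Other? xs)) (fewInClass k)
        fewLikeX : length (filter (λ a → class a ≟ class x) xs) < B
        fewLikeX = subst (λ l → length l ≤ B) (filter-accept (λ a → class a ≟ class x) refl) (fewInClass (class x))
        big′ : B + s * B ≤ length (filter (λ a → class a ≟ class x) xs) + length others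
        big′ = ≤-trans (s≤s⁻¹ big) (≤-reflexive (length-filter+reject (λ a → class a ≟ class x) xs))

-- Counting the indices that admit a witness

module _ {r : ℕ} where

  Keyed : (Fin r → Set) → Set
  Keyed F = List (Σ (Fin r) F)

  keys : {F : Fin r → Set} → Keyed F → List (Fin r)
  keys = map proj₁

  DistinctKeys : {F : Fin r → Set} → Keyed F → Set
  DistinctKeys = AllPairs (λ p q → proj₁ p ≢ proj₁ q)

  AtMost : ℕ → (Fin r → Set) → Set
  AtMost B F = (L : Keyed F) → DistinctKeys L → length L ≤ B

  module _ {F F′ : Fin r → Set} {P : Σ (Fin r) F → Set} (g : ∀ {i} x → P (i , x) → F′ i) where

    retag : (L : Keyed F) → All P L → Keyed F′
    retag []            []       = []
    retag ((i , x) ∷ L) (p ∷ ps) = (i , g x p) ∷ retag L ps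

    keys-retag : ∀ L ps → keys (retag L ps) ≡ keys L
    keys-retag []            []       = refl
    keys-retag ((i , x) ∷ L) (p ∷ ps) = cong (i ∷_) (keys-retag L ps)

    AtMost-All : ∀ {B} → AtMost B F′ → ∀ L → DistinctKeys L → All P L → length L ≤ B
    AtMost-All {B} bound L distinct ps = subst (_≤ B) length-retag (bound (retag L ps) distinct′)
      where
        length-retag : length (retag L ps) ≡ length L
        length-retag = trans (sym (length-map proj₁ (retag L ps)))
                             (trans (cong length (keys-retag L ps)) (length-map proj₁ L))
        distinct′ : DistinctKeys (retag L ps)
        distinct′ = AllPairs.map⁻ (subst (AllPairs _≢_) (sym (keys-retag L ps)) (AllPairs.map⁺ distinct))

    AtMost-filter : ∀ {B} (P? : ∀ p → Dec (P p)) → AtMost B F′ →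
                    ∀ L → DistinctKeys L → length (filter P? L) ≤ B
    AtMost-filter P? bound L distinct =
      AtMost-All bound (filter P? L) (AllPairs.filter⁺ P? distinct) (all-filter P? L)

  IsInj₁ : {A B : Set} → A ⊎ B → Set
  IsInj₁ {A} s = Σ A λ a → s ≡ inj₁ a

  isInj₁? : {A B : Set} (s : A ⊎ B) → Dec (IsInj₁ s)
  isInj₁? (inj₁ a) = yes (a , refl)
  isInj₁? (inj₂ b) = no λ ()

  AtMost-⊎ : ∀ {B₁ B₂} {F₁ F₂ : Fin r → Set} → AtMost B₁ F₁ → AtMost B₂ F₂ →
             AtMost (B₁ + B₂) (λ i → F₁ i ⊎ F₂ i)
  AtMost-⊎ {F₁ = F₁} {F₂} bound₁ bound₂ L distinct =
    ≤-trans (≤-reflexive (length-filter+reject (isInj₁? ∘ proj₂) L))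
            (+-mono-≤ (AtMost-filter left (isInj₁? ∘ proj₂) bound₁ L distinct)
                      (AtMost-filter right (¬? ∘ isInj₁? ∘ proj₂) bound₂ L distinct))
    where
      left : ∀ {i} (s : F₁ i ⊎ F₂ i) → IsInj₁ s → F₁ i
      left s (a , _) = a
      right : ∀ {i} (s : F₁ i ⊎ F₂ i) → ¬ IsInj₁ s → F₂ i
      right (inj₁ a) notInj₁ = ⊥-elim (notInj₁ (a , refl))
      right (inj₂ b) _       = b

  AtMost-map : ∀ {B} {F F′ : Fin r → Set} → (∀ {i} → F i → F′ i) → AtMost B F′ → AtMost B F
  AtMost-map {B} f bound L distinct =
    subst (_≤ B) (length-map _ L) (bound (map (λ (i , x) → i , f x) L) (AllPairs.map⁺ distinct))

  AtMost-everywhere : ∀ {B} {F : Fin r → Set} → (∀ i → F i) → AtMost B F → r ≤ B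
  AtMost-everywhere {B} f bound =
    subst (_≤ B) (trans (length-map _ (allFin r)) (length-tabulate _))
          (bound (map (λ i → i , f i) (allFin r)) (AllPairs.map⁺ (allFin⁺ r)))

module _ {n} (G : Graph n) where

  Adj-sym : ∀ {x y} → Adj G x y → Adj G y x
  Adj-sym {x} {y} = trans (Graph.sym G y x)

  Adj-irrefl : ∀ {x} → ¬ Adj G x x
  Adj-irrefl {x} xx with trans (sym xx) (irrefl G x)
  ... | ()

  ¬Adj⇒adj≡false : ∀ {x y} → ¬ Adj G x y → adj G x y ≡ false
  ¬Adj⇒adj≡false {x} {y} ¬xy with adj G x y
  ... | true  = ⊥-elim (¬xy refl)
  ... | false = refl

  pairwiseAdjacent⇒IsClique : ∀ {s} (c : Fin s → Fin n) → (∀ i j → i ≢ j → Adj G (c i) (c j)) → IsClique G c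
  pairwiseAdjacent⇒IsClique c adjacent = injective , adjacent
    where
      injective : ∀ {i j} → c i ≡ c j → i ≡ j
      injective {i} {j} ci≡cj with i ≟ᶠ j
      ... | yes i≡j = i≡j
      ... | no  i≢j = ⊥-elim (Adj-irrefl (subst (Adj G (c i)) (sym ci≡cj) (adjacent i j i≢j)))

  2≤cliqueNumber : ∀ {ω x y} → Adj G x y → ¬ HasCliqueOfSize G (suc ω) → 2 ≤ ω
  2≤cliqueNumber {zero} {x} _ noClique =
    ⊥-elim (noClique (_ , pairwiseAdjacent⇒IsClique (λ _ → x) λ { zero zero 0≢0 → ⊥-elim (0≢0 refl) }))
  2≤cliqueNumber {suc zero} {x} {y} xy noClique = ⊥-elim (noClique (_ , pairwiseAdjacent⇒IsClique edge adjacent))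
    where
      edge : Fin 2 → Fin n
      edge zero       = x
      edge (suc zero) = y
      adjacent : ∀ i j → i ≢ j → Adj G (edge i) (edge j)
      adjacent zero       zero       i≢j = ⊥-elim (i≢j refl)
      adjacent zero       (suc zero) _   = xy
      adjacent (suc zero) zero       _   = Adj-sym xy
      adjacent (suc zero) (suc zero) i≢j = ⊥-elim (i≢j refl)
  2≤cliqueNumber {suc (suc ω)} _ _ = s≤s (s≤s z≤n)

  KttFree⇒0<t : ∀ {t} → KttFree t G → 0 < t
  KttFree⇒0<t {zero}  free =
    ⊥-elim (free ((λ ()) , (λ ()) , (λ { {()} }) , (λ { {()} }) , (λ ()) , (λ ()) , (λ ()) , (λ ())))
  KttFree⇒0<t {suc t} _    = s≤s z≤n

module LeafPathVertices {n} {G : Graph n} {Z : Subset n} {v : Fin n} (P : LeafPath G Z v) where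

  at : (k : ℕ) → .(k ≤ len P) → Fin n
  at k k≤len = vert P (fromℕ< (s≤s k≤len))

  at-onPath : ∀ k .(k≤len : k ≤ len P) → OnPath P (at k k≤len)
  at-onPath k k≤len = fromℕ< (s≤s k≤len) , refl

  at-adjacent : ∀ k (k<len : k < len P) → Adj G (at (suc k) k<len) (at k (<⇒≤ k<len))
  at-adjacent k k<len = from (proj₂ (path P) (fromℕ< (s≤s k<len)) (fromℕ< (s≤s (<⇒≤ k<len))))
    (inj₁ (trans (toℕ-fromℕ< (s≤s k<len)) (cong suc (sym (toℕ-fromℕ< (s≤s (<⇒≤ k<len)))))))

  at-start : at 0 z≤n ∈ Z
  at-start = start P

  at-len : ∀ {k} .(k≤len : k ≤ len P) → k ≡ len P → at k k≤len ≡ v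
  at-len {k} k≤len k≡len = trans (cong (vert P) (trans (fromℕ<-cong k (len P) k≡len _ _) (sym (fromℕ-def (len P)))))
                                 (finish P)

  at≡v⇒len : ∀ {k} .(k≤len : k ≤ len P) → at k k≤len ≡ v → k ≡ len P
  at≡v⇒len {k} k≤len at≡v = trans (sym (toℕ-fromℕ< (s≤s k≤len)))
    (trans (cong toℕ (proj₁ (path P) (trans at≡v (sym (finish P))))) (toℕ-fromℕ (len P)))

  at-≢v : ∀ {k} .(k≤len : k ≤ len P) → k < len P → at k k≤len ≢ v
  at-≢v k≤len k<len = <⇒≢ k<len ∘ at≡v⇒len k≤len

  0<len : v ∉ Z → 0 < len P
  0<len v∉Z = n≢0⇒n>0 λ len≡0 → v∉Z (subst (_∈ Z) (at-len z≤n (sym len≡0)) at-start)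

leafPath-hasEdge : ∀ {n} {G : Graph n} {Z v} → v ∉ Z → LeafPath G Z v → ∃₂ (Adj G)
leafPath-hasEdge v∉Z P = _ , _ , at-adjacent 0 (0<len v∉Z)
  where open LeafPathVertices P

Ends : ∀ {m} → Fin m → Fin m → Fin m → Set
Ends u a b = u ≡ a ⊎ u ≡ b

byEnd : ∀ {m} {F : Fin m → Set} {u a b} → Ends u a b → F u → F a ⊎ F b
byEnd (inj₁ refl) x = inj₁ x
byEnd (inj₂ refl) x = inj₂ x

TriangleEdge : ∀ {m} (c₁ c₂ c₃ a b : Fin m) → Set
TriangleEdge c₁ c₂ c₃ a b = (a , b) ≡ (c₁ , c₂) ⊎ (a , b) ≡ (c₁ , c₃) ⊎ (a , b) ≡ (c₂ , c₃)

triangleEdges-meet : ∀ {m} {c₁ c₂ c₃ a b c d : Fin m} →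
  TriangleEdge c₁ c₂ c₃ a b → TriangleEdge c₁ c₂ c₃ c d → (a , b) ≢ (c , d) →
  Σ (Fin m) λ u → Ends u a b × Ends u c d
triangleEdges-meet (inj₁ refl)        (inj₁ refl)        ab≢cd = ⊥-elim (ab≢cd refl)
triangleEdges-meet (inj₁ refl)        (inj₂ (inj₁ refl)) _     = _ , inj₁ refl , inj₁ refl
triangleEdges-meet (inj₁ refl)        (inj₂ (inj₂ refl)) _     = _ , inj₂ refl , inj₁ refl
triangleEdges-meet (inj₂ (inj₁ refl)) (inj₁ refl)        _     = _ , inj₁ refl , inj₁ refl
triangleEdges-meet (inj₂ (inj₁ refl)) (inj₂ (inj₁ refl)) ab≢cd = ⊥-elim (ab≢cd refl)
triangleEdges-meet (inj₂ (inj₁ refl)) (inj₂ (inj₂ refl)) _     = _ , inj₂ refl , inj₂ refl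
triangleEdges-meet (inj₂ (inj₂ refl)) (inj₁ refl)        _     = _ , inj₁ refl , inj₂ refl
triangleEdges-meet (inj₂ (inj₂ refl)) (inj₂ (inj₁ refl)) _     = _ , inj₂ refl , inj₂ refl
triangleEdges-meet (inj₂ (inj₂ refl)) (inj₂ (inj₂ refl)) ab≢cd = ⊥-elim (ab≢cd refl)

triangleEdge-isEdge : ∀ {m} {H : Graph m} {c₁ c₂ c₃ a b} →
  IsTriangle H c₁ c₂ c₃ → TriangleEdge c₁ c₂ c₃ a b → IsEdge H a b
triangleEdge-isEdge (c₁<c₂ , _      , c₁c₂ , _    , _   ) (inj₁ refl)        = c₁<c₂ , c₁c₂
triangleEdge-isEdge (c₁<c₂ , c₂<c₃ , _    , c₁c₃ , _   ) (inj₂ (inj₁ refl)) = <-trans c₁<c₂ c₂<c₃ , c₁c₃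
triangleEdge-isEdge (_     , c₂<c₃ , _    , _    , c₂c₃) (inj₂ (inj₂ refl)) = c₂<c₃ , c₂c₃

_≟ᵖ_ : ∀ {m} → DecidableEquality (Piece m)
pv a     ≟ᵖ pv b        = map′ (cong pv) (λ { refl → refl }) (a ≟ᶠ b)
pe a b   ≟ᵖ pe c d      =
  map′ (λ { (refl , refl) → refl }) (λ { refl → refl , refl }) (a ≟ᶠ c ×-dec b ≟ᶠ d)
pt a b c ≟ᵖ pt a′ b′ c′ =
  map′ (λ { (refl , refl , refl) → refl }) (λ { refl → refl , refl , refl })
       (a ≟ᶠ a′ ×-dec b ≟ᶠ b′ ×-dec c ≟ᶠ c′)
pv _     ≟ᵖ pe _ _      = no λ ()
pv _     ≟ᵖ pt _ _ _    = no λ ()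
pe _ _   ≟ᵖ pv _        = no λ ()
pe _ _   ≟ᵖ pt _ _ _    = no λ ()
pt _ _ _ ≟ᵖ pv _        = no λ ()
pt _ _ _ ≟ᵖ pe _ _      = no λ ()

_≟ᵉ_ : ∀ {m} → DecidableEquality (Fin m × Fin m)
_≟ᵉ_ = ≡-dec _≟ᶠ_ _≟ᶠ_

module StripDecomposition {n m} {G : Graph n} {Z : Subset n} {H : Graph m} (E : ESD G Z H) where
  open ESD E public

  data Location (x : Fin n) : Set where
    vertexStrip   : ∀ h → η (pv h) x → Location x
    edgeStrip     : ∀ {a b} → IsEdge H a b → η (pe a b) x → Location x
    triangleStrip : ∀ {c₁ c₂ c₃} → IsTriangle H c₁ c₂ c₃ → η (pt c₁ c₂ c₃) x → Location x

  locate : ∀ x → Location x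
  locate x with cover x
  ... | pv h       , _         , x∈ = vertexStrip h x∈
  ... | pe a b     , ab        , x∈ = edgeStrip ab x∈
  ... | pt c₁ c₂ c₃ , c₁c₂c₃    , x∈ = triangleStrip c₁c₂c₃ x∈

  samePiece : ∀ {x p q} → IsPiece H p → IsPiece H q → η p x → η q x → p ≡ q
  samePiece {x} {p} {q} = unique x p q

  η? : ∀ {p} → IsPiece H p → ∀ x → Dec (η p x)
  η? {p} p-piece x with cover x
  ... | q , q-piece , x∈q with q ≟ᵖ p
  ...   | yes refl = yes x∈q
  ...   | no  q≢p  = no λ x∈p → q≢p (samePiece q-piece p-piece x∈q x∈p)

  pe-injective : ∀ {a b c d : Fin m} → pe a b ≡ pe c d → (a , b) ≡ (c , d)
  pe-injective refl = refl

  sameEdge : ∀ {a b c d x} → IsEdge H a b → IsEdge H c d → η (pe a b) x → η (pe c d) x → (a , b) ≡ (c , d)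
  sameEdge ab cd x∈ab x∈cd = pe-injective (samePiece ab cd x∈ab x∈cd)

  inStrip : ∀ {a b u x} → IsEdge H a b → Ends u a b → ηEnd a b u x → η (pe a b) x
  inStrip {a} {b} {u} {x} = endSub a b u x

  endsAdjacent : ∀ {a b c d u x y} → IsEdge H a b → IsEdge H c d → (a , b) ≢ (c , d) →
    Ends u a b → Ends u c d → ηEnd a b u x → ηEnd c d u y → Adj G x y
  endsAdjacent {a} {b} {c} {d} {u} {x} {y} ab cd ab≢cd u∈ab u∈cd x∈ y∈ =
    from (edgeAdj a b c d ab cd (ab≢cd ∘ pe-injective) x y (inStrip ab u∈ab x∈) (inStrip cd u∈cd y∈))
         (u , u∈ab , u∈cd , x∈ , y∈)

  edgeStrips-disjoint : ∀ {a b c d x y} → IsEdge H a b → IsEdge H c d → (a , b) ≢ (c , d) →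
    η (pe a b) x → η (pe c d) y → x ≢ y
  edgeStrips-disjoint ab cd ab≢cd x∈ y∈ refl = ab≢cd (sameEdge ab cd x∈ y∈)

  edgeStrip∌vertexStrip : ∀ {a b c x} → IsEdge H a b → η (pe a b) x → ¬ η (pv c) x
  edgeStrip∌vertexStrip ab x∈ab x∈c with samePiece tt ab x∈c x∈ab
  ... | ()

  edgeStrip∌triangleStrip : ∀ {a b c₁ c₂ c₃ x} → IsEdge H a b → IsTriangle H c₁ c₂ c₃ →
    η (pe a b) x → ¬ η (pt c₁ c₂ c₃) x
  edgeStrip∌triangleStrip ab T x∈ab x∈T with samePiece T ab x∈T x∈ab
  ... | ()

  BothEnds : Fin m → Fin m → Fin n → Set
  BothEnds a b x = ηEnd a b a x × ηEnd a b b x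

  bothEnds⇒end : ∀ {a b u x} → Ends u a b → BothEnds a b x → ηEnd a b u x
  bothEnds⇒end (inj₁ refl) = proj₁
  bothEnds⇒end (inj₂ refl) = proj₂

  VertexEntry : Fin m → Fin m → Fin m → Fin n → Set
  VertexEntry h a b y = IsEdge H a b × Ends h a b × ηEnd a b h y

  TriangleEntry : Fin m → Fin m → Fin m → Fin m → Fin m → Fin n → Set
  TriangleEntry c₁ c₂ c₃ a b y = IsEdge H a b × TriangleEdge c₁ c₂ c₃ a b × BothEnds a b y

  vertexEntries-adjacent : ∀ h {a b c d x y} → VertexEntry h a b x → VertexEntry h c d y →
    (a , b) ≢ (c , d) → Adj G x y
  vertexEntries-adjacent h (ab , h∈ab , x∈) (cd , h∈cd , y∈) ab≢cd =
    endsAdjacent ab cd ab≢cd h∈ab h∈cd x∈ y∈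

  triangleEntries-adjacent : ∀ {c₁ c₂ c₃ a b c d x y} →
    TriangleEntry c₁ c₂ c₃ a b x → TriangleEntry c₁ c₂ c₃ c d y → (a , b) ≢ (c , d) → Adj G x y
  triangleEntries-adjacent (ab , ab∈T , x∈) (cd , cd∈T , y∈) ab≢cd with triangleEdges-meet ab∈T cd∈T ab≢cd
  ... | u , u∈ab , u∈cd = endsAdjacent ab cd ab≢cd u∈ab u∈cd (bothEnds⇒end u∈ab x∈) (bothEnds⇒end u∈cd y∈)

  vertexExit : ∀ {h x y} → η (pv h) x → ¬ η (pv h) y → Adj G x y →
    Σ (Fin m) λ a → Σ (Fin m) λ b → VertexEntry h a b y
  vertexExit {h} {x} {y} = vertexAdj h x y

  triangleExit : ∀ {c₁ c₂ c₃ x y} → IsTriangle H c₁ c₂ c₃ →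
    η (pt c₁ c₂ c₃) x → ¬ η (pt c₁ c₂ c₃) y → Adj G x y →
    Σ (Fin m) λ a → Σ (Fin m) λ b → TriangleEntry c₁ c₂ c₃ a b y
  triangleExit {c₁} {c₂} {c₃} {x} {y} T x∈ y∉ xy with triangleAdj c₁ c₂ c₃ T x y x∈ y∉ xy
  ... | inj₁ y∈        = c₁ , c₂ , triangleEdge-isEdge {H = H} T (inj₁ refl) , inj₁ refl , y∈
  ... | inj₂ (inj₁ y∈) = c₁ , c₃ , triangleEdge-isEdge {H = H} T (inj₂ (inj₁ refl)) , inj₂ (inj₁ refl) , y∈
  ... | inj₂ (inj₂ y∈) = c₂ , c₃ , triangleEdge-isEdge {H = H} T (inj₂ (inj₂ refl)) , inj₂ (inj₂ refl) , y∈

  Z-inEdgeStrip : ∀ {z} → z ∈ Z → Σ (Fin m) λ a → Σ (Fin m) λ b → IsEdge H a b × η (pe a b) z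
  Z-inEdgeStrip {z} z∈Z with leaves z z∈Z
  ... | w , _ , a , b , ab , w∈ab , η[ab,w]≡z = a , b , ab , inStrip ab w∈ab (from (η[ab,w]≡z z) refl)

  IsLeafEnd : Fin m → Fin m → Fin m → Fin n → Set
  IsLeafEnd a b w z = ∀ y → ηEnd a b w y ⇔ y ≡ z

  Z-leafEnd : ∀ {a b z} → z ∈ Z → IsEdge H a b → η (pe a b) z → IsLeafEnd a b a z ⊎ IsLeafEnd a b b z
  Z-leafEnd {z = z} z∈Z ab z∈ab with leaves z z∈Z
  ... | w , _ , a′ , b′ , a′b′ , w∈a′b′ , leaf
    with sameEdge a′b′ ab (inStrip a′b′ w∈a′b′ (from (leaf z) refl)) z∈ab
  ...   | refl with w∈a′b′
  ...     | inj₁ refl = inj₁ leaf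
  ...     | inj₂ refl = inj₂ leaf

-- Following a leaf path back to Z

module PathInDecomposition {n m} {G : Graph n} {Z : Subset n} {H : Graph m} (E : ESD G Z H)
                           {v : Fin n} (P : LeafPath G Z v) where
  open StripDecomposition E
  open LeafPathVertices P

  start-inEdgeStrip : ∀ {p} → IsPiece H p → η p (at 0 z≤n) → Σ (Fin m) λ a → Σ (Fin m) λ b → p ≡ pe a b
  start-inEdgeStrip p-piece z∈p with Z-inEdgeStrip at-start
  ... | a , b , ab , z∈ab = a , b , samePiece p-piece ab z∈p z∈ab

  record Departure (Entry : Fin m → Fin m → Fin n → Set) : Set where
    field
      a b   : Fin m
      j     : ℕ
      j<len : j < len P
      entry : Entry a b (at j (<⇒≤ j<len))

  leaveVertexStrip : ∀ {h} k (k≤len : k ≤ len P) → η (pv h) (at k k≤len) → Departure (VertexEntry h)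
  leaveVertexStrip zero _ z∈ with start-inEdgeStrip tt z∈
  ... | _ , _ , ()
  leaveVertexStrip {h} (suc k) k<len x∈ with η? {pv h} tt (at k (<⇒≤ k<len))
  ... | yes y∈ = leaveVertexStrip k (<⇒≤ k<len) y∈
  ... | no  y∉ with vertexExit x∈ y∉ (at-adjacent k k<len)
  ...   | a , b , entry = record { a = a ; b = b ; j = k ; j<len = k<len ; entry = entry }

  leaveTriangleStrip : ∀ {c₁ c₂ c₃} → IsTriangle H c₁ c₂ c₃ → ∀ k (k≤len : k ≤ len P) →
    η (pt c₁ c₂ c₃) (at k k≤len) → Departure (TriangleEntry c₁ c₂ c₃)
  leaveTriangleStrip T zero _ z∈ with start-inEdgeStrip T z∈
  ... | _ , _ , ()
  leaveTriangleStrip T (suc k) k<len x∈ with η? T (at k (<⇒≤ k<len))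
  ... | yes y∈ = leaveTriangleStrip T k (<⇒≤ k<len) y∈
  ... | no  y∉ with triangleExit T x∈ y∉ (at-adjacent k k<len)
  ...   | a , b , entry = record { a = a ; b = b ; j = k ; j<len = k<len ; entry = entry }

  module Walk (K : ℕ) (K≤len : K ≤ len P) where

    atK : (k : ℕ) → .(k ≤ K) → Fin n
    atK k k≤K = at k (≤-trans k≤K K≤len)

    atK-adjacent : ∀ k (k<K : k < K) → Adj G (atK (suc k) k<K) (atK k (<⇒≤ k<K))
    atK-adjacent k k<K = at-adjacent k (<-≤-trans k<K K≤len)

    -- j is the position of a vertex in η(ab, c), resp. in both ends of ab, from which the walk
    -- entered the vertex or triangle strip.
    data Territory (a b : Fin m) (k : ℕ) (k≤K : k ≤ K) : Set where
      inEdge     : η (pe a b) (atK k k≤K) → Territory a b k k≤K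
      inVertex   : ∀ {c} → Ends c a b → η (pv c) (atK k k≤K) →
                   ∀ j (j≤K : j ≤ K) → ηEnd a b c (atK j j≤K) → Territory a b k k≤K
      inTriangle : ∀ {c₁ c₂ c₃} → IsTriangle H c₁ c₂ c₃ → TriangleEdge c₁ c₂ c₃ a b →
                   η (pt c₁ c₂ c₃) (atK k k≤K) →
                   ∀ j (j≤K : j ≤ K) → BothEnds a b (atK j j≤K) → Territory a b k k≤K

    data WalkEnd (a b : Fin m) : Set where
      startsInEdge : η (pe a b) (at 0 z≤n) → WalkEnd a b
      crosses      : ∀ {u f₁ f₂} → Ends u a b → IsEdge H f₁ f₂ → Ends u f₁ f₂ → (a , b) ≢ (f₁ , f₂) →
                     ∀ jx (jx≤K : jx ≤ K) → ηEnd a b u (atK jx jx≤K) →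
                     ∀ jy (jy<K : jy < K) → ηEnd f₁ f₂ u (atK jy (<⇒≤ jy<K)) → WalkEnd a b

    Step : Fin m → Fin m → (k : ℕ) → k < K → Set
    Step a b k k<K = Territory a b k (<⇒≤ k<K) ⊎ WalkEnd a b

    stepFromEdge : ∀ {a b} → IsEdge H a b → ∀ k (k<K : k < K) → η (pe a b) (atK (suc k) k<K) → Step a b k k<K
    stepFromEdge {a} {b} ab k k<K x∈ with locate (atK k (<⇒≤ k<K))
    ... | vertexStrip c y∈ with vertexExit y∈ (edgeStrip∌vertexStrip ab x∈) (Adj-sym G (atK-adjacent k k<K))
    ...   | a′ , b′ , a′b′ , c∈a′b′ , x∈end with sameEdge a′b′ ab (inStrip a′b′ c∈a′b′ x∈end) x∈
    ...     | refl = inj₁ (inVertex c∈a′b′ y∈ (suc k) k<K x∈end)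
    stepFromEdge {a} {b} ab k k<K x∈ | edgeStrip {c} {d} cd y∈ with (c , d) ≟ᵉ (a , b)
    ... | yes refl = inj₁ (inEdge y∈)
    ... | no  cd≢ab with to (edgeAdj a b c d ab cd (cd≢ab ∘ sym ∘ pe-injective) _ _ x∈ y∈) (atK-adjacent k k<K)
    ...   | u , u∈ab , u∈cd , x∈end , y∈end =
            inj₂ (crosses u∈ab cd u∈cd (cd≢ab ∘ sym) (suc k) k<K x∈end k k<K y∈end)
    stepFromEdge {a} {b} ab k k<K x∈ | triangleStrip T y∈
      with triangleExit T y∈ (edgeStrip∌triangleStrip ab T x∈) (Adj-sym G (atK-adjacent k k<K))
    ... | a′ , b′ , a′b′ , a′b′∈T , x∈ends with sameEdge a′b′ ab (inStrip a′b′ (inj₁ refl) (proj₁ x∈ends)) x∈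
    ...   | refl = inj₁ (inTriangle T a′b′∈T y∈ (suc k) k<K x∈ends)

    stepFromVertex : ∀ {a b c} → Ends c a b → ∀ k (k<K : k < K) → η (pv c) (atK (suc k) k<K) →
      ∀ j (j≤K : j ≤ K) → ηEnd a b c (atK j j≤K) → Step a b k k<K
    stepFromVertex {a} {b} {c} c∈ab k k<K x∈ j j≤K w∈end with η? {pv c} tt (atK k (<⇒≤ k<K))
    ... | yes y∈ = inj₁ (inVertex c∈ab y∈ j j≤K w∈end)
    ... | no  y∉ with vertexExit x∈ y∉ (atK-adjacent k k<K)
    ...   | f₁ , f₂ , f , c∈f , y∈end with (f₁ , f₂) ≟ᵉ (a , b)
    ...     | yes refl = inj₁ (inEdge (inStrip f c∈f y∈end))
    ...     | no  f≢ab = inj₂ (crosses c∈ab f c∈f (f≢ab ∘ sym) j j≤K w∈end k k<K y∈end)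

    stepFromTriangle : ∀ {a b c₁ c₂ c₃} → IsTriangle H c₁ c₂ c₃ → TriangleEdge c₁ c₂ c₃ a b →
      ∀ k (k<K : k < K) → η (pt c₁ c₂ c₃) (atK (suc k) k<K) →
      ∀ j (j≤K : j ≤ K) → BothEnds a b (atK j j≤K) → Step a b k k<K
    stepFromTriangle {a} {b} T ab∈T k k<K x∈ j j≤K w∈ends with η? T (atK k (<⇒≤ k<K))
    ... | yes y∈ = inj₁ (inTriangle T ab∈T y∈ j j≤K w∈ends)
    ... | no  y∉ with triangleExit T x∈ y∉ (atK-adjacent k k<K)
    ...   | f₁ , f₂ , f , f∈T , y∈ends with (f₁ , f₂) ≟ᵉ (a , b)
    ...     | yes refl = inj₁ (inEdge (inStrip f (inj₁ refl) (proj₁ y∈ends)))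
    ...     | no  f≢ab with triangleEdges-meet ab∈T f∈T (f≢ab ∘ sym)
    ...       | u , u∈ab , u∈f = inj₂ (crosses u∈ab f u∈f (f≢ab ∘ sym)
                                         j j≤K (bothEnds⇒end u∈ab w∈ends) k k<K (bothEnds⇒end u∈f y∈ends))

    step : ∀ {a b} → IsEdge H a b → ∀ k (k<K : k < K) → Territory a b (suc k) k<K → Step a b k k<K
    step ab k k<K (inEdge x∈)                     = stepFromEdge ab k k<K x∈
    step ab k k<K (inVertex c∈ab x∈ j j≤K w∈)     = stepFromVertex c∈ab k k<K x∈ j j≤K w∈
    step ab k k<K (inTriangle T ab∈T x∈ j j≤K w∈) = stepFromTriangle T ab∈T k k<K x∈ j j≤K w∈

    walk : ∀ {a b} → IsEdge H a b → ∀ k (k≤K : k ≤ K) → Territory a b k k≤K → WalkEnd a b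
    walk ab zero    _ (inEdge z∈) = startsInEdge z∈
    walk ab zero    _ (inVertex _ z∈ _ _ _) with start-inEdgeStrip tt z∈
    ... | _ , _ , ()
    walk ab zero    _ (inTriangle T _ z∈ _ _ _) with start-inEdgeStrip T z∈
    ... | _ , _ , ()
    walk ab (suc k) k<K territory with step ab k k<K territory
    ... | inj₁ territory′ = walk ab k (<⇒≤ k<K) territory′
    ... | inj₂ end        = end

-- Bounding the number of paths

outcomeBound : ℕ → ℕ → ℕ
outcomeBound ω t = 2 + (ramseyNumber (suc ω) t + ramseyNumber (suc ω) t)

familyBound : ℕ → ℕ → ℕ
familyBound ω t = 2 + (ω * outcomeBound ω t + ω * outcomeBound ω t)

module LeafPathFamily {n m} {G : Graph n} {Z : Subset n} {H : Graph m} (E : ESD G Z H)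
  {ω : ℕ} (noClique : ¬ HasCliqueOfSize G (suc ω)) {t : ℕ} (Ktt-free : KttFree t G)
  {v : Fin n} (v∉Z : v ∉ Z) {r : ℕ} (P : Fin r → LeafPath G Z v) (disjoint : PairwiseDisjointExcept v P) where

  open StripDecomposition E

  disjoint-≢ : ∀ {i j x y} → i ≢ j → OnPath (P i) x → OnPath (P j) y → x ≢ v → x ≢ y
  disjoint-≢ i≢j x∈Pi y∈Pj x≢v refl = x≢v (disjoint _ _ i≢j _ x∈Pi y∈Pj)

  record EndVisit (u : Fin m) (i : Fin r) : Set where
    field
      vertex : Fin n
      e₁ e₂  : Fin m
      isEdge : IsEdge H e₁ e₂
      atEnd  : Ends u e₁ e₂
      inEnd  : ηEnd e₁ e₂ u vertex
      onPath : OnPath (P i) vertex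
      ≢v     : vertex ≢ v

    edge : Fin m × Fin m
    edge = e₁ , e₂

  open EndVisit

  VisitAt : Fin m → Set
  VisitAt u = Σ (Fin r) (EndVisit u)

  record Crossing (u : Fin m) (i : Fin r) : Set where
    field
      first second : EndVisit u i
      different    : edge first ≢ edge second

  open Crossing

  avoiding : ∀ {u i} (g : Fin m × Fin m) → Crossing u i → Σ (EndVisit u i) λ w → edge w ≢ g
  avoiding g c with edge (first c) ≟ᵉ g
  ... | yes refl = second c , different c ∘ sym
  ... | no  ≢g   = first c , ≢g

  Scattered : {A : Set} → (A → Fin r) → (A → Fin n) → (Fin t → A) → Set
  Scattered key vertexOf xs = ∀ i j → i ≢ j → key (xs i) ≢ key (xs j) × ¬ Adj G (vertexOf (xs i)) (vertexOf (xs j))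

  scatteredSubfamily : ∀ {A : Set} (key : A → Fin r) (vertexOf : A → Fin n) (L : List A) →
    AllPairs (λ p q → key p ≢ key q) L → ramseyNumber (suc ω) t ≤ length L →
    Σ (Fin t → A) (Scattered key vertexOf)
  scatteredSubfamily key vertexOf L distinct many
    with ramsey (λ p q → Adj G (vertexOf p) (vertexOf q)) (λ p q → adj G (vertexOf p) (vertexOf q) ≟ᵇ true)
                (Adj-sym G)
                (λ p q → key p ≢ key q) (_∘ sym) (suc ω) t L distinct many
  ... | inj₁ (c , _ , adjacent)  = ⊥-elim (noClique (_ , pairwiseAdjacent⇒IsClique G (vertexOf ∘ c) adjacent))
  ... | inj₂ (c , _ , scattered) = c , scattered

  scattered-sameEdge : ∀ {u} (xs : Fin t → VisitAt u) → Scattered proj₁ (vertex ∘ proj₂) xs →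
    ∀ i j → edge (proj₂ (xs i)) ≡ edge (proj₂ (xs j))
  scattered-sameEdge {u} xs scattered i j with i ≟ᶠ j | edge (proj₂ (xs i)) ≟ᵉ edge (proj₂ (xs j))
  ... | yes refl | _         = refl
  ... | no  _    | yes same  = same
  ... | no  i≢j  | no  ≢edge =
    ⊥-elim (proj₂ (scattered i j i≢j)
      (endsAdjacent (isEdge x) (isEdge y) ≢edge (atEnd x) (atEnd y) (inEnd x) (inEnd y)))
    where
      x : EndVisit u (proj₁ (xs i))
      x = proj₂ (xs i)
      y : EndVisit u (proj₁ (xs j))
      y = proj₂ (xs j)

  scattered⇒Ktt : ∀ {u} (xs ys : Fin t → VisitAt u) →
    Scattered proj₁ (vertex ∘ proj₂) xs → Scattered proj₁ (vertex ∘ proj₂) ys →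
    (∀ i j → edge (proj₂ (xs i)) ≢ edge (proj₂ (ys j))) →
    IsInducedKtt t G (vertex ∘ proj₂ ∘ xs) (vertex ∘ proj₂ ∘ ys)
  scattered⇒Ktt {u} xs ys xs-scattered ys-scattered xs≢ys =
    injective xs xs-scattered , injective ys ys-scattered , apart , adjacent ,
    stable xs xs-scattered , stable ys ys-scattered
    where
      injective : ∀ zs → Scattered proj₁ (vertex ∘ proj₂) zs →
                  ∀ {i j} → vertex (proj₂ (zs i)) ≡ vertex (proj₂ (zs j)) → i ≡ j
      injective zs scattered {i} {j} same with i ≟ᶠ j
      ... | yes i≡j = i≡j
      ... | no  i≢j = ⊥-elim (disjoint-≢ (proj₁ (scattered i j i≢j))
                                (onPath (proj₂ (zs i))) (onPath (proj₂ (zs j))) (≢v (proj₂ (zs i))) same)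
      stable : ∀ zs → Scattered proj₁ (vertex ∘ proj₂) zs →
               ∀ i j → adj G (vertex (proj₂ (zs i))) (vertex (proj₂ (zs j))) ≡ false
      stable zs scattered i j with i ≟ᶠ j
      ... | yes refl = irrefl G _
      ... | no  i≢j  = ¬Adj⇒adj≡false G (proj₂ (scattered i j i≢j))
      x : ∀ i → EndVisit u (proj₁ (xs i))
      x i = proj₂ (xs i)
      y : ∀ j → EndVisit u (proj₁ (ys j))
      y j = proj₂ (ys j)
      apart : ∀ i j → vertex (x i) ≢ vertex (y j)
      apart i j = edgeStrips-disjoint (isEdge (x i)) (isEdge (y j)) (xs≢ys i j)
        (inStrip (isEdge (x i)) (atEnd (x i)) (inEnd (x i))) (inStrip (isEdge (y j)) (atEnd (y j)) (inEnd (y j)))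
      adjacent : ∀ i j → Adj G (vertex (x i)) (vertex (y j))
      adjacent i j = endsAdjacent (isEdge (x i)) (isEdge (y j)) (xs≢ys i j)
        (atEnd (x i)) (atEnd (y j)) (inEnd (x i)) (inEnd (y j))

  crossings-AtMost : ∀ u → AtMost (ramseyNumber (suc ω) t) (Crossing u)
  crossings-AtMost u L distinct = <⇒≤ (≰⇒> (λ many → Ktt-free (_ , _ , Ktt many)))
    where
      -- Pairwise non-adjacent first visits lie in one end η(g, u), to which every visit of another
      -- end at u is complete.
      module _ (many : ramseyNumber (suc ω) t ≤ length L) where
        firstScattered : Σ (Fin t → Σ (Fin r) (Crossing u)) (Scattered proj₁ (vertex ∘ first ∘ proj₂))
        firstScattered = scatteredSubfamily proj₁ (vertex ∘ first ∘ proj₂) L distinct many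

        xs : Fin t → VisitAt u
        xs i = proj₁ (proj₁ firstScattered i) , first (proj₂ (proj₁ firstScattered i))

        g : Fin m × Fin m
        g = edge (proj₂ (xs (fromℕ< (KttFree⇒0<t G Ktt-free))))

        avoidingScattered :
          Σ (Fin t → Σ (Fin r) (Crossing u)) (Scattered proj₁ (vertex ∘ proj₁ ∘ avoiding g ∘ proj₂))
        avoidingScattered = scatteredSubfamily proj₁ (vertex ∘ proj₁ ∘ avoiding g ∘ proj₂) L distinct many

        ys : Fin t → VisitAt u
        ys j = proj₁ (proj₁ avoidingScattered j) , proj₁ (avoiding g (proj₂ (proj₁ avoidingScattered j)))

        Ktt : IsInducedKtt t G (vertex ∘ proj₂ ∘ xs) (vertex ∘ proj₂ ∘ ys)
        Ktt = scattered⇒Ktt xs ys (proj₂ firstScattered) (proj₂ avoidingScattered) λ i j xs≡ys →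
          proj₂ (avoiding g (proj₂ (proj₁ avoidingScattered j)))
            (trans (sym xs≡ys) (scattered-sameEdge xs (proj₂ firstScattered) i _))

  startOf : Fin r → Fin n
  startOf i = LeafPathVertices.at (P i) 0 z≤n

  startsAtLeafEnd-AtMost1 : ∀ a b w → AtMost 1 (λ i → IsLeafEnd a b w (startOf i))
  startsAtLeafEnd-AtMost1 a b w []                               _                     = z≤n
  startsAtLeafEnd-AtMost1 a b w (_ ∷ [])                         _                     = s≤s z≤n
  startsAtLeafEnd-AtMost1 a b w ((i , leafᵢ) ∷ (j , leafⱼ) ∷ _) ((i≢j ∷ _) ∷ _) =
    ⊥-elim (disjoint-≢ i≢j (at-onPath (P i) 0 z≤n) (at-onPath (P j) 0 z≤n) (startOf≢v i)
                       (to (leafⱼ (startOf i)) (from (leafᵢ (startOf i)) refl)))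
    where
      open LeafPathVertices using (at-onPath)
      startOf≢v : ∀ i → startOf i ≢ v
      startOf≢v i start≡v = v∉Z (subst (_∈ Z) start≡v (LeafPathVertices.at-start (P i)))

  StartsIn : Fin m → Fin m → Fin r → Set
  StartsIn a b i = IsEdge H a b × η (pe a b) (startOf i)

  startsIn-AtMost2 : ∀ a b → AtMost 2 (StartsIn a b)
  startsIn-AtMost2 a b = AtMost-map (λ {i} (ab , start∈) → Z-leafEnd (LeafPathVertices.at-start (P i)) ab start∈)
                                    (AtMost-⊎ (startsAtLeafEnd-AtMost1 a b a) (startsAtLeafEnd-AtMost1 a b b))

  Outcome : Fin m → Fin m → Fin r → Set
  Outcome a b i = StartsIn a b i ⊎ Crossing a i ⊎ Crossing b i

  outcome-AtMost : ∀ a b → AtMost (outcomeBound ω t) (Outcome a b)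
  outcome-AtMost a b = AtMost-⊎ (startsIn-AtMost2 a b) (AtMost-⊎ (crossings-AtMost a) (crossings-AtMost b))

  module AlongPath (i : Fin r) where
    open LeafPathVertices (P i) public
    open PathInDecomposition E (P i) public

    visitAt : ∀ {u e₁ e₂} j (j<len : j < len (P i)) → IsEdge H e₁ e₂ → Ends u e₁ e₂ →
              ηEnd e₁ e₂ u (at j (<⇒≤ j<len)) → EndVisit u i
    visitAt j j<len e u∈e x∈ = record
      { vertex = _ ; e₁ = _ ; e₂ = _ ; isEdge = e ; atEnd = u∈e ; inEnd = x∈
      ; onPath = at-onPath j (<⇒≤ j<len) ; ≢v = at-≢v (<⇒≤ j<len) j<len }

    module _ (K : ℕ) (K<len : K < len (P i)) where
      open Walk K (<⇒≤ K<len)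

      outcomeOfWalk : ∀ {a b} → IsEdge H a b → WalkEnd a b → Outcome a b i
      outcomeOfWalk ab (startsInEdge start∈) = inj₁ (ab , start∈)
      outcomeOfWalk ab (crosses u∈ab f u∈f ab≢f jx jx≤K x∈ jy jy<K y∈) =
        inj₂ (byEnd {F = λ u → Crossing u i} u∈ab record
          { first     = visitAt jx (≤-<-trans jx≤K K<len) ab u∈ab x∈
          ; second    = visitAt jy (<-trans jy<K K<len) f u∈f y∈
          ; different = ab≢f })

    outcomeFrom : ∀ {a b} j (j<len : j < len (P i)) → IsEdge H a b → η (pe a b) (at j (<⇒≤ j<len)) → Outcome a b i
    outcomeFrom j j<len ab x∈ = outcomeOfWalk j j<len ab (walk ab j ≤-refl (inEdge x∈))
      where open Walk j (<⇒≤ j<len)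

    atLen : ∀ {p} → η p v → η p (at (len (P i)) ≤-refl)
    atLen {p} = subst (η p) (sym (at-len ≤-refl refl))

  module Star (Entry : Fin m → Fin m → Fin n → Set)
              (entry-inStrip : ∀ {a b y} → Entry a b y → IsEdge H a b × η (pe a b) y)
              (entries-adjacent : ∀ {a b c d x y} → Entry a b x → Entry c d y → (a , b) ≢ (c , d) → Adj G x y) where

    record Exit (i : Fin r) : Set where
      constructor exit
      field
        a b     : Fin m
        y       : Fin n
        entry   : Entry a b y
        outcome : Outcome a b i

    open Exit

    exitEdge : Σ (Fin r) Exit → Fin m × Fin m
    exitEdge (_ , x) = a x , b x

    exits-AtMost : AtMost (ω * outcomeBound ω t) Exit
    exits-AtMost L distinct = ≮⇒≥ λ many →
      noClique (_ , pairwiseAdjacent⇒IsClique G (y ∘ proj₂ ∘ proj₁ (clique many)) (proj₂ (proj₂ (clique many))))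
      where
        fewPerEdge : ∀ e → length (filter (λ p → exitEdge p ≟ᵉ e) L) ≤ outcomeBound ω t
        fewPerEdge (e₁ , e₂) =
          AtMost-filter outcomeAt (λ p → exitEdge p ≟ᵉ (e₁ , e₂)) (outcome-AtMost e₁ e₂) L distinct
          where
            outcomeAt : ∀ {i} (x : Exit i) → exitEdge (i , x) ≡ (e₁ , e₂) → Outcome e₁ e₂ i
            outcomeAt x refl = outcome x
        clique : ω * outcomeBound ω t < length L → Clique (λ p q → Adj G (y (proj₂ p)) (y (proj₂ q))) L (suc ω)
        clique = pigeonhole-clique _≟ᵉ_ exitEdge (λ p q → Adj G (y (proj₂ p)) (y (proj₂ q)))
                   (λ p q → entries-adjacent (entry (proj₂ p)) (entry (proj₂ q))) (outcomeBound ω t) ω L fewPerEdge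

    departureExit : ∀ i → PathInDecomposition.Departure E (P i) Entry → Exit i
    departureExit i d = exit D.a D.b _ D.entry (uncurry (outcomeFrom D.j D.j<len) (entry-inStrip D.entry))
      where
        open AlongPath i
        module D = Departure d

  vertexEntry-inStrip : ∀ {h a b y} → VertexEntry h a b y → IsEdge H a b × η (pe a b) y
  vertexEntry-inStrip (ab , h∈ab , y∈) = ab , inStrip ab h∈ab y∈

  triangleEntry-inStrip : ∀ {c₁ c₂ c₃ a b y} → TriangleEntry c₁ c₂ c₃ a b y → IsEdge H a b × η (pe a b) y
  triangleEntry-inStrip (ab , _ , y∈) = ab , inStrip ab (inj₁ refl) (proj₁ y∈)

  module VertexStar (h : Fin m) = Star (VertexEntry h) vertexEntry-inStrip (vertexEntries-adjacent h)

  vertexCase : ∀ {h} → η (pv h) v → r ≤ ω * outcomeBound ω t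
  vertexCase {h} v∈ = AtMost-everywhere exitOf exits-AtMost
    where
      open VertexStar h
      exitOf : ∀ i → Exit i
      exitOf i = departureExit i (leaveVertexStrip (len (P i)) ≤-refl (atLen v∈))
        where open AlongPath i

  triangleCase : ∀ {c₁ c₂ c₃} → IsTriangle H c₁ c₂ c₃ → η (pt c₁ c₂ c₃) v →
                 r ≤ ω * outcomeBound ω t
  triangleCase {c₁} {c₂} {c₃} T v∈ = AtMost-everywhere exitOf exits-AtMost
    where
      open Star (TriangleEntry c₁ c₂ c₃) triangleEntry-inStrip triangleEntries-adjacent
      exitOf : ∀ i → Exit i
      exitOf i = departureExit i (leaveTriangleStrip T (len (P i)) ≤-refl (atLen v∈))
        where open AlongPath i

  edgeCase : ∀ {a b} → IsEdge H a b → η (pe a b) v → r ≤ familyBound ω t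
  edgeCase {a} {b} ab v∈ = AtMost-everywhere classify
    (AtMost-⊎ (startsIn-AtMost2 a b) (AtMost-⊎ (VertexStar.exits-AtMost a) (VertexStar.exits-AtMost b)))
    where
      module _ (i : Fin r) where
        open AlongPath i
        open Walk (len (P i)) ≤-refl

        classify : StartsIn a b i ⊎ VertexStar.Exit a i ⊎ VertexStar.Exit b i
        classify with walk ab (len (P i)) ≤-refl (inEdge (atLen v∈))
        ... | startsInEdge start∈ = inj₁ (ab , start∈)
        ... | crosses {u} u∈ab f u∈f ab≢f jx jx≤len x∈ jy jy<len y∈ =
          inj₂ (byEnd {F = λ u → VertexStar.Exit u i} u∈ab exitAtCrossing)
          where
            open VertexStar u using (Exit; exit)
            -- If x is v itself, the path leaves the strip of v through the end of f containing y.
            exitAtCrossing : Exit i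
            exitAtCrossing with jx <? len (P i)
            ... | yes jx<len = exit a b _ (ab , u∈ab , x∈) (inj₂ (byEnd {F = λ u → Crossing u i} u∈ab record
                    { first     = visitAt jx jx<len ab u∈ab x∈
                    ; second    = visitAt jy jy<len f u∈f y∈
                    ; different = ab≢f }))
            ... | no  _      = exit _ _ _ (f , u∈f , y∈) (outcomeFrom jy jy<len f (inStrip f u∈f y∈))

  r≤familyBound : r ≤ familyBound ω t
  r≤familyBound with locate v
  ... | vertexStrip _ v∈   = ≤-trans (vertexCase v∈) (≤-trans (m≤m+n _ _) (m≤n+m _ 2))
  ... | triangleStrip T v∈ = ≤-trans (triangleCase T v∈) (≤-trans (m≤m+n _ _) (m≤n+m _ 2))
  ... | edgeStrip ab v∈    = edgeCase ab v∈

module _ {y : ℕ} (2≤y : 2 ≤ y) where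

  +-≤-^ : ∀ {a b} p → a ≤ y ^ p → b ≤ y ^ p → a + b ≤ y ^ suc p
  +-≤-^ {a} {b} p a≤ b≤ = begin
    a + b           ≤⟨ +-mono-≤ a≤ b≤ ⟩
    y ^ p + y ^ p   ≡⟨ cong (y ^ p +_) (sym (+-identityʳ (y ^ p))) ⟩
    2 * y ^ p       ≤⟨ *-monoˡ-≤ (y ^ p) 2≤y ⟩
    y ^ suc p       ∎
    where open ≤-Reasoning

  2≤^suc : ∀ p → 2 ≤ y ^ suc p
  2≤^suc p = ≤-trans 2≤y (m≤m*n y (y ^ p) ⦃ m^n≢0 y p ⦃ y≢0 ⦄ ⦄)
    where
      y≢0 : NonZero y
      y≢0 = >-nonZero (≤-trans (s≤s z≤n) 2≤y)

*-≤-^ : ∀ {y a b} p q → a ≤ y ^ p → b ≤ y ^ q → a * b ≤ y ^ (p + q)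
*-≤-^ {y} p q a≤ b≤ = ≤-trans (*-mono-≤ a≤ b≤) (≤-reflexive (sym (^-distribˡ-+-* y p q)))

2+m≤m^2 : ∀ {m} → 2 ≤ m → 2 + m ≤ m ^ 2
2+m≤m^2 {m} 2≤m = begin
  2 + m      ≡⟨ +-comm 2 m ⟩
  m + 2      ≤⟨ +-monoʳ-≤ m 2≤m ⟩
  m + m      ≡⟨ cong (m +_) (sym (+-identityʳ m)) ⟩
  2 * m      ≤⟨ *-monoˡ-≤ m 2≤m ⟩
  m * m      ≡⟨ cong (m *_) (sym (*-identityʳ m)) ⟩
  m ^ 2      ∎
  where open ≤-Reasoning

familyBound≤pow : ∀ {ω} t → 2 ≤ ω → familyBound ω t ≤ ω ^ (2 * (5 + t))
familyBound≤pow {ω} t 2≤ω = begin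
  familyBound ω t        ≤⟨ +-≤-^ 2≤y (4 + t) (2≤^suc 2≤y (3 + t)) (+-≤-^ 2≤y (3 + t) ωB≤ ωB≤) ⟩
  y ^ (5 + t)            ≤⟨ ^-monoˡ-≤ (5 + t) (2+m≤m^2 2≤ω) ⟩
  (ω ^ 2) ^ (5 + t)      ≡⟨ ^-*-assoc ω 2 (5 + t) ⟩
  ω ^ (2 * (5 + t))      ∎
  where
    open ≤-Reasoning
    y : ℕ
    y = 2 + ω
    2≤y : 2 ≤ y
    2≤y = m≤m+n 2 ω
    R≤ : ramseyNumber (suc ω) t ≤ y ^ t
    R≤ = <⇒≤ (ramseyNumber<pow (suc ω) t)
    ωB≤ : ω * outcomeBound ω t ≤ y ^ (3 + t)
    ωB≤ = *-≤-^ 1 (2 + t) (≤-trans (m≤n+m ω 2) (≤-reflexive (sym (*-identityʳ y))))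
                          (+-≤-^ 2≤y (1 + t) (2≤^suc 2≤y t) (+-≤-^ 2≤y t R≤ R≤))

lemma4p4 : (t : ℕ) → Σ ℕ λ c →
    ∀ {n} (G : Graph n) (ω : ℕ) → IsCliqueNumber G ω → KttFree t G →
    (Z : Subset n) → 2 ≤ ∣ Z ∣ →
    ∀ {m} (H : Graph m) → ESD G Z H →
    (v : Fin n) → v ∉ Z →
    (r : ℕ) (P : Fin r → LeafPath G Z v) → PairwiseDisjointExcept v P →
    r ≤ ω ^ c
lemma4p4 t = 2 * (5 + t) , λ where
  G ω (_ , noClique) Ktt-free Z _ H E v v∉Z zero    P disjoint → z≤n
  G ω (_ , noClique) Ktt-free Z _ H E v v∉Z (suc r) P disjoint →
    let _ , _ , xy = leafPath-hasEdge v∉Z (P zero) in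
    ≤-trans (LeafPathFamily.r≤familyBound E noClique Ktt-free v∉Z P disjoint)
            (familyBound≤pow t (2≤cliqueNumber G xy noClique))
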